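{- Let $R$ be a commutative $\mathbb Q$-algebra, $a,b,c\in R$, and let $\Xi=(\xi_{i,j})_{i,j\ge1}$ be the infinite matrix with $\xi_{i,j}=a$ for $i<j$, $\xi_{i,i}=b$, and $\xi_{i,j}=c$ for $i>j$. For $n\ge1$ let $\Xi_n=(\xi_{i,j})_{1\le i,j\le n}$. Then in $R[[u]]$, $$\Bigl(1+\sum_{n\ge1}\frac{u^n}{n!}\operatorname{per}\Xi_n\Bigr)^{ -1}=1+\sum_{n\ge1}\frac{(-u)^n}{n!}\det\Xi_n,$$ where $\operatorname{per}$ denotes the permanent.
   Context: The permanent of an $n\times n$ matrix $(x_{i,j})$ is $\sum_{\sigma\in\mathfrak S_n}x_{1,\sigma(1)}\cdots x_{n,\sigma(n)}$. -}

module Defs where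

open import Level using (Level)
open import Algebra.Bundles using (CommutativeRing)
open import Data.Nat using (ℕ; zero; suc; _∸_; _<ᵇ_; _≡ᵇ_)
open import Data.Nat.Base using () renaming (_+_ to _+ℕ_)
open import Data.Bool using (Bool; true; false; if_then_else_; not; _∧_)
open import Data.Fin using (Fin; toℕ)
open import Data.List using (List; []; _∷_; map; concatMap; foldr; allFin; upTo)
open import Data.Vec.Functional using () renaming (_∷_ to consF)

allFuns : (n m : ℕ) → List (Fin n → Fin m)
allFuns zero    m = (λ ()) ∷ []
allFuns (suc n) m =
  concatMap (λ f → map (λ x → consF x f) (allFin m)) (allFuns n m)

anyPair : {A : Set} → (n : ℕ) → (Fin n → Fin n → A) → List A
anyPair n f = concatMap (λ i → concatMap (λ j → if toℕ i <ᵇ toℕ j then f i j ∷ [] else []) (allFin n)) (allFin n)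

-- σ : Fin n → Fin n is a permutation iff it is injective (finite set).
isPerm : {n : ℕ} → (Fin n → Fin n) → Bool
isPerm {n} σ = foldr _∧_ true (anyPair n (λ i j → not (toℕ (σ i) ≡ᵇ toℕ (σ j))))

inversions : {n : ℕ} → (Fin n → Fin n) → ℕ
inversions {n} σ = foldr _+ℕ_ 0 (anyPair n (λ i j → if toℕ (σ j) <ᵇ toℕ (σ i) then 1 else 0))

isEven : ℕ → Bool
isEven zero = true
isEven (suc n) = not (isEven n)

module _ {c ℓ : Level} (R : CommutativeRing c ℓ) where
  open CommutativeRing R

  sumR : List Carrier → Carrier
  sumR = foldr _+_ 0#

  prodFin : (n : ℕ) → (Fin n → Carrier) → Carrier
  prodFin n f = foldr _*_ 1# (map f (allFin n))

  sgn : {n : ℕ} → (Fin n → Fin n) → Carrier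
  sgn σ = if isEven (inversions σ) then 1# else (- 1#)

  per : (n : ℕ) → (Fin n → Fin n → Carrier) → Carrier
  per n M = sumR (map (λ σ → if isPerm σ then prodFin n (λ i → M i (σ i)) else 0#) (allFuns n n))

  det : (n : ℕ) → (Fin n → Fin n → Carrier) → Carrier
  det n M = sumR (map (λ σ → if isPerm σ then sgn σ * prodFin n (λ i → M i (σ i)) else 0#) (allFuns n n))

  natR : ℕ → Carrier
  natR zero = 0#
  natR (suc n) = 1# + natR n

  -- 1/n! = Π_{k<n} inv k, where inv k is the inverse of (k+1)
  invFact : (ℕ → Carrier) → ℕ → Carrier
  invFact inv zero = 1#
  invFact inv (suc n) = invFact inv n * inv n

  negOnePow : ℕ → Carrier
  negOnePow n = if isEven n then 1# else (- 1#)

  Xi : Carrier → Carrier → Carrier → (n : ℕ) → Fin n → Fin n → Carrier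
  Xi a b c n i j =
    if toℕ i <ᵇ toℕ j then a else (if toℕ i ≡ᵇ toℕ j then b else c)

  -- formal power series in R[[u]] as coefficient sequences
  Series : Set c
  Series = ℕ → Carrier

  _⋆_ : Series → Series → Series
  (f ⋆ g) N = sumR (map (λ k → f k * g (N ∸ k)) (upTo (suc N)))

  oneS : Series
  oneS zero = 1#
  oneS (suc n) = 0#

  perSeries : (ℕ → Carrier) → Carrier → Carrier → Carrier → Series
  perSeries inv a b c zero = 1#
  perSeries inv a b c (suc n) = invFact inv (suc n) * per (suc n) (Xi a b c (suc n))

  detSeries : (ℕ → Carrier) → Carrier → Carrier → Carrier → Series
  detSeries inv a b c zero = 1#
  detSeries inv a b c (suc n) =
    negOnePow (suc n) * (invFact inv (suc n) * det (suc n) (Xi a b c (suc n)))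

-- Write qPer q M = ∑_σ q ^ inv(σ) ∏ M i (σ i), so that per = qPer 1 and det = qPer (-1), and let
-- T_q(u) = ∑_n q^n u^n/n! qPer q Ξ_n, so the claim is T_1 · T_{-1} = 1. Expanding qPer Ξ_{n+1} along
-- its first row and then along the first column of each minor gives, for q² = 1,
--   qPer Ξ_{n+1} = b · qPer Ξ_n + q a c · ∂(qPer Ξ_n),
-- where ∂ is the derivative as a, b, c all move at unit speed: by Jacobi's formula (a consequence of the
-- row expansion and of the fact that swapping two rows multiplies qPer by q) ∂ qPer M is the signed sum
-- of the (n-1)-minors, and those of Ξ_{n+1} are exactly what the column expansion produces. Hence T_q' = q b T_q + a c ∂T_q, and the b-terms cancel in
-- (T_1 T_{-1})' = a c ∂(T_1 T_{-1}). The coefficients of T_1 T_{-1} are now computed by induction on the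
-- degree N, simultaneously over all commutative rings: the induction hypothesis over the dual numbers
-- R[ε] with entries a + ε, b + ε, c + ε says that ∂(T_1 T_{-1}) vanishes in degree N, so (N+1) times the
-- coefficient of degree N+1 vanishes, and N+1 is invertible.
module Submission where

open import Defs
open import Level using (Level; 0ℓ)
open import Algebra.Bundles using (CommutativeRing; Monoid; CommutativeMonoid; AbelianGroup)
import Algebra.Construct.DirectProduct as DirectProduct
open import Data.Product using (_×_; _,_; proj₁; proj₂; zip) renaming (map to map×)
open import Data.Product.Relation.Binary.Pointwise.NonDependent using (Pointwise)
open import Data.Nat using (ℕ; zero; suc; _∸_; _<ᵇ_; _≡ᵇ_; _≤_; z≤n; s≤s)
import Data.Nat.Properties as ℕ
open import Data.Nat using () renaming (_+_ to _ℕ+_)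
open import Data.Bool using (Bool; true; false; if_then_else_; not; _∧_)
open import Data.Bool.Properties using (∧-commutativeMonoid; ∧-conicalˡ; ∧-conicalʳ; not-involutive; if-float; if-eta)
open import Data.Fin using (Fin; toℕ; punchIn; fromℕ<) renaming (zero to fzero; suc to fsuc)
open import Data.Fin.Properties using (toℕ-fromℕ<; toℕ≤pred[n])
open import Data.Empty using (⊥-elim)
open import Data.List using (List; []; [_]; applyUpTo; upTo; _++_; map; concatMap; foldr; allFin; tabulate)
open import Data.List.Properties using (map-tabulate; map-concatMap; map-∘)
open import Function using (_∘_; id; const)
open import Relation.Binary.PropositionalEquality as ≡ using (_≡_; _≗_)

module ListFolds {c ℓ} (M : Monoid c ℓ) where
  open import Data.List using (_∷_)
  open Monoid M
  open import Algebra.Properties.Monoid.Sum M using (sum)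

  fold : List Carrier → Carrier
  fold = foldr _∙_ ε

  fold-++ : ∀ xs ys → fold (xs ++ ys) ≈ fold xs ∙ fold ys
  fold-++ []       ys = sym (identityˡ _)
  fold-++ (x ∷ xs) ys = trans (∙-congˡ (fold-++ xs ys)) (sym (assoc x _ _))

  fold-concatMap : {A : Set} (h : A → List Carrier) (xs : List A) →
                   fold (concatMap h xs) ≈ fold (map (fold ∘ h) xs)
  fold-concatMap h []       = refl
  fold-concatMap h (x ∷ xs) = trans (fold-++ (h x) _) (∙-congˡ (fold-concatMap h xs))

  fold-map-cong : {A : Set} {f g : A → Carrier} (xs : List A) →
                  (∀ x → f x ≈ g x) → fold (map f xs) ≈ fold (map g xs)
  fold-map-cong []       f≈g = refl
  fold-map-cong (x ∷ xs) f≈g = ∙-cong (f≈g x) (fold-map-cong xs f≈g)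

  fold-tabulate : ∀ n (f : Fin n → Carrier) → fold (tabulate f) ≈ sum f
  fold-tabulate zero    f = refl
  fold-tabulate (suc n) f = ∙-congˡ (fold-tabulate n (f ∘ fsuc))

  fold-allFin : ∀ n (f : Fin n → Carrier) → fold (map f (allFin n)) ≈ sum f
  fold-allFin n f = trans (reflexive (≡.cong fold (map-tabulate id f))) (fold-tabulate n f)

module PairSums {ℓ} (M : Monoid 0ℓ ℓ) where
  open Monoid M
  open import Algebra.Properties.Monoid.Sum M using (sum; sum-cong-≋)
  open ListFolds M

  pairSum : ∀ n → (Fin n → Fin n → Carrier) → Carrier
  pairSum zero    g = ε
  pairSum (suc n) g = sum (λ j → g fzero (fsuc j)) ∙ pairSum n (λ i j → g (fsuc i) (fsuc j))

  pairSum-cong : ∀ n {g h : Fin n → Fin n → Carrier} →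
                 (∀ i j → g i j ≈ h i j) → pairSum n g ≈ pairSum n h
  pairSum-cong zero    g≈h = refl
  pairSum-cong (suc n) g≈h =
    ∙-cong (sum-cong-≋ (g≈h fzero ∘ fsuc)) (pairSum-cong n (λ i j → g≈h (fsuc i) (fsuc j)))

  fold-anyPair : ∀ n (g : Fin n → Fin n → Carrier) → fold (anyPair n g) ≈ pairSum n g
  fold-anyPair n g = begin
    fold (anyPair n g)
      ≈⟨ fold-concatMap _ (allFin n) ⟩
    fold (map (λ i → fold (concatMap (entry g i) (allFin n))) (allFin n))
      ≈⟨ fold-map-cong (allFin n) (λ i → trans (fold-concatMap (entry g i) (allFin n)) (fold-allFin n _)) ⟩
    fold (map (λ i → sum (fold ∘ entry g i)) (allFin n))
      ≈⟨ fold-allFin n _ ⟩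
    sum (λ i → sum (fold ∘ entry g i))
      ≈⟨ triangle n g ⟩
    pairSum n g ∎
    where
    open import Relation.Binary.Reasoning.Setoid setoid
    entry : ∀ {n} → (Fin n → Fin n → Carrier) → Fin n → Fin n → List Carrier
    entry g i j = if toℕ i <ᵇ toℕ j then [ g i j ] else []
    triangle : ∀ n (g : Fin n → Fin n → Carrier) → sum (λ i → sum (fold ∘ entry g i)) ≈ pairSum n g
    triangle zero    g = refl
    triangle (suc n) g = ∙-cong
      (begin
        ε ∙ sum (λ j → g fzero (fsuc j) ∙ ε) ≈⟨ identityˡ _ ⟩
        sum (λ j → g fzero (fsuc j) ∙ ε)     ≈⟨ sum-cong-≋ {n} (λ j → identityʳ _) ⟩
        sum (λ j → g fzero (fsuc j))         ∎)
      (begin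
        sum (λ i → ε ∙ sum (fold ∘ entry g′ i)) ≈⟨ sum-cong-≋ {n} (λ i → identityˡ _) ⟩
        sum (λ i → sum (fold ∘ entry g′ i))     ≈⟨ triangle n g′ ⟩
        pairSum n g′                           ∎)
      where
      g′ : Fin n → Fin n → Carrier
      g′ i j = g (fsuc i) (fsuc j)

open PairSums (CommutativeMonoid.monoid ∧-commutativeMonoid) using ()
  renaming (pairSum to allPairs; fold-anyPair to foldr-∧-anyPair; pairSum-cong to allPairs-cong)
open PairSums ℕ.+-0-monoid using ()
  renaming (pairSum to sumPairs; fold-anyPair to foldr-+-anyPair; pairSum-cong to sumPairs-cong)
open import Algebra.Properties.CommutativeMonoid.Sum ℕ.+-0-commutativeMonoid using ()
  renaming (sum to sumℕ; sum-cong-≗ to sumℕ-cong; ∑-comm to sumℕ-comm; sum-remove to sumℕ-remove;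
            ∑-distrib-+ to sumℕ-distrib-+; sum-replicate-zero to sumℕ-zeros)
open import Algebra.Properties.Monoid.Sum (CommutativeMonoid.monoid ∧-commutativeMonoid) using ()
  renaming (sum to and)

open import Data.Vec.Functional using (_∷_; removeAt)

𝟙 : Bool → ℕ
𝟙 b = if b then 1 else 0

isInjective : ∀ {n m} → (Fin n → Fin m) → Bool
isInjective {n} f = allPairs n (λ i j → not (toℕ (f i) ≡ᵇ toℕ (f j)))

inversionCount : ∀ {n m} → (Fin n → Fin m) → ℕ
inversionCount {n} f = sumPairs n (λ i j → 𝟙 (toℕ (f j) <ᵇ toℕ (f i)))

isPerm≡isInjective : ∀ {n} (σ : Fin n → Fin n) → isPerm σ ≡ isInjective σ
isPerm≡isInjective {n} σ = foldr-∧-anyPair n _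

inversions≡inversionCount : ∀ {n} (σ : Fin n → Fin n) → inversions σ ≡ inversionCount σ
inversions≡inversionCount {n} σ = foldr-+-anyPair n _

avoids : ∀ {n m} → Fin m → (Fin n → Fin m) → Bool
avoids x f = and (λ j → not (toℕ x ≡ᵇ toℕ (f j)))

countBelow : ∀ {n m} → (Fin n → Fin m) → ℕ → ℕ
countBelow f k = sumℕ (λ j → 𝟙 (toℕ (f j) <ᵇ k))

multiplicity : ∀ {n m} → (Fin n → Fin m) → ℕ → ℕ
multiplicity f k = sumℕ (λ j → 𝟙 (k ≡ᵇ toℕ (f j)))

module Injections where
  open ≡ using (refl; sym; trans; cong; cong₂)
  open Data.Nat using (_+_)

  ≡ᵇ-refl : ∀ k → (k ≡ᵇ k) ≡ true
  ≡ᵇ-refl zero    = refl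
  ≡ᵇ-refl (suc k) = ≡ᵇ-refl k

  ≡ᵇ⇒≡ : ∀ a b → (a ≡ᵇ b) ≡ true → a ≡ b
  ≡ᵇ⇒≡ zero    zero    _ = refl
  ≡ᵇ⇒≡ (suc a) (suc b) p = cong suc (≡ᵇ⇒≡ a b p)

  not-true : ∀ {b} → not b ≡ true → b ≡ false
  not-true {b} p = trans (sym (not-involutive b)) (cong not p)

  punchIn-≡ᵇ : ∀ {m} (x : Fin (suc m)) (a b : Fin m) →
               (toℕ (punchIn x a) ≡ᵇ toℕ (punchIn x b)) ≡ (toℕ a ≡ᵇ toℕ b)
  punchIn-≡ᵇ fzero    a        b        = refl
  punchIn-≡ᵇ (fsuc x) fzero    fzero    = refl
  punchIn-≡ᵇ (fsuc x) fzero    (fsuc b) = refl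
  punchIn-≡ᵇ (fsuc x) (fsuc a) fzero    = refl
  punchIn-≡ᵇ (fsuc x) (fsuc a) (fsuc b) = punchIn-≡ᵇ x a b

  punchIn-<ᵇ : ∀ {m} (x : Fin (suc m)) (a b : Fin m) →
               (toℕ (punchIn x a) <ᵇ toℕ (punchIn x b)) ≡ (toℕ a <ᵇ toℕ b)
  punchIn-<ᵇ fzero    a        b        = refl
  punchIn-<ᵇ (fsuc x) fzero    fzero    = refl
  punchIn-<ᵇ (fsuc x) fzero    (fsuc b) = refl
  punchIn-<ᵇ (fsuc x) (fsuc a) fzero    = refl
  punchIn-<ᵇ (fsuc x) (fsuc a) (fsuc b) = punchIn-<ᵇ x a b

  punchIn-<ᵇ-pivot : ∀ {m} (x : Fin (suc m)) (v : Fin m) →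
                     (toℕ (punchIn x v) <ᵇ toℕ x) ≡ (toℕ v <ᵇ toℕ x)
  punchIn-<ᵇ-pivot fzero    v        = refl
  punchIn-<ᵇ-pivot (fsuc x) fzero    = refl
  punchIn-<ᵇ-pivot (fsuc x) (fsuc v) = punchIn-<ᵇ-pivot x v

  punchIn-≢ᵇ-pivot : ∀ {m} (x : Fin (suc m)) (v : Fin m) → (toℕ (punchIn x v) ≡ᵇ toℕ x) ≡ false
  punchIn-≢ᵇ-pivot fzero    v        = refl
  punchIn-≢ᵇ-pivot (fsuc x) fzero    = refl
  punchIn-≢ᵇ-pivot (fsuc x) (fsuc v) = punchIn-≢ᵇ-pivot x v

  𝟙-<ᵇ-suc : ∀ a k → 𝟙 (a <ᵇ suc k) ≡ 𝟙 (a <ᵇ k) + 𝟙 (k ≡ᵇ a)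
  𝟙-<ᵇ-suc zero    zero    = refl
  𝟙-<ᵇ-suc zero    (suc k) = refl
  𝟙-<ᵇ-suc (suc a) zero    = refl
  𝟙-<ᵇ-suc (suc a) (suc k) = 𝟙-<ᵇ-suc a k

  and-true : ∀ n (b : Fin n → Bool) → and b ≡ true → ∀ j → b j ≡ true
  and-true (suc n) b p fzero    = ∧-conicalˡ (b fzero) _ p
  and-true (suc n) b p (fsuc j) = and-true n (b ∘ fsuc) (∧-conicalʳ (b fzero) _ p) j

  sumℕ-ones : ∀ n → sumℕ (λ (_ : Fin n) → 1) ≡ n
  sumℕ-ones zero    = refl
  sumℕ-ones (suc n) = cong suc (sumℕ-ones n)

  sumℕ-≤1 : ∀ n (c : Fin n → ℕ) → (∀ v → c v ≤ 1) → sumℕ c ≤ n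
  sumℕ-≤1 zero    c c≤1 = z≤n
  sumℕ-≤1 (suc n) c c≤1 = ℕ.+-mono-≤ (c≤1 fzero) (sumℕ-≤1 n (c ∘ fsuc) (c≤1 ∘ fsuc))

  sum≡n⇒all≡1 : ∀ n (c : Fin n → ℕ) → (∀ v → c v ≤ 1) → sumℕ c ≡ n → ∀ v → c v ≡ 1
  sum≡n⇒all≡1 (suc n) c c≤1 Σc≡n v with c v in cv | c≤1 v
  ... | 1           | _       = refl
  ... | suc (suc _) | s≤s ()
  ... | 0           | _       = ⊥-elim (ℕ.<-irrefl refl (ℕ.≤-trans (ℕ.≤-reflexive (sym rest≡)) rest≤))
    where
    rest≤ : sumℕ (c ∘ punchIn v) ≤ n
    rest≤ = sumℕ-≤1 n (c ∘ punchIn v) (c≤1 ∘ punchIn v)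
    rest≡ : sumℕ (c ∘ punchIn v) ≡ suc n
    rest≡ = trans (cong (_+ sumℕ (c ∘ punchIn v)) (sym cv)) (trans (sym (sumℕ-remove {i = v} c)) Σc≡n)

  multiplicity≤1 : ∀ {n m} (f : Fin n → Fin m) → isInjective f ≡ true → ∀ k → multiplicity f k ≤ 1
  multiplicity≤1 {zero}  f inj k = z≤n
  multiplicity≤1 {suc n} f inj k with k ≡ᵇ toℕ (f fzero) in k≡f₀
  ... | false = multiplicity≤1 (f ∘ fsuc) (∧-conicalʳ _ _ inj) k
  ... | true  = ℕ.≤-reflexive (cong suc (trans (sumℕ-cong others-differ) (sumℕ-zeros n)))
    where
    others-differ : ∀ j → 𝟙 (k ≡ᵇ toℕ (f (fsuc j))) ≡ 0
    others-differ j rewrite ≡ᵇ⇒≡ k _ k≡f₀ =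
      cong 𝟙 (not-true (and-true n _ (∧-conicalˡ _ _ inj) j))

  sum-multiplicity : ∀ {n m} (f : Fin n → Fin m) → sumℕ (λ (v : Fin m) → multiplicity f (toℕ v)) ≡ n
  sum-multiplicity {n} {m} f = begin
    sumℕ (λ (v : Fin m) → sumℕ (λ j → 𝟙 (toℕ v ≡ᵇ toℕ (f j))))
      ≡⟨ sumℕ-comm (λ (v : Fin m) j → 𝟙 (toℕ v ≡ᵇ toℕ (f j))) ⟩
    sumℕ (λ j → sumℕ (λ (v : Fin m) → 𝟙 (toℕ v ≡ᵇ toℕ (f j))))
      ≡⟨ sumℕ-cong (hits-once ∘ f) ⟩
    sumℕ (λ (_ : Fin n) → 1)
      ≡⟨ sumℕ-ones n ⟩
    n ∎
    where
    open ≡.≡-Reasoning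
    hits-once : ∀ {m} (w : Fin m) → sumℕ (λ (v : Fin m) → 𝟙 (toℕ v ≡ᵇ toℕ w)) ≡ 1
    hits-once {suc m} w = begin
      sumℕ (λ (v : Fin (suc m)) → 𝟙 (toℕ v ≡ᵇ toℕ w))
        ≡⟨ sumℕ-remove {i = w} (λ v → 𝟙 (toℕ v ≡ᵇ toℕ w)) ⟩
      𝟙 (toℕ w ≡ᵇ toℕ w) + sumℕ (λ v → 𝟙 (toℕ (punchIn w v) ≡ᵇ toℕ w))
        ≡⟨ cong₂ _+_ (cong 𝟙 (≡ᵇ-refl (toℕ w))) (trans (sumℕ-cong (cong 𝟙 ∘ punchIn-≢ᵇ-pivot w)) (sumℕ-zeros m)) ⟩
      1 ∎

  countBelow-bijection : ∀ {n} (f : Fin n → Fin n) → isInjective f ≡ true →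
                         ∀ k → k ≤ n → countBelow f k ≡ k
  countBelow-bijection {n} f inj zero    _   = sumℕ-zeros n
  countBelow-bijection {n} f inj (suc k) k<n = begin
    countBelow f (suc k)
      ≡⟨ sumℕ-cong (λ j → 𝟙-<ᵇ-suc (toℕ (f j)) k) ⟩
    sumℕ (λ j → 𝟙 (toℕ (f j) <ᵇ k) + 𝟙 (k ≡ᵇ toℕ (f j)))
      ≡⟨ sumℕ-distrib-+ (λ j → 𝟙 (toℕ (f j) <ᵇ k)) (λ j → 𝟙 (k ≡ᵇ toℕ (f j))) ⟩
    countBelow f k + multiplicity f k
      ≡⟨ cong₂ _+_ (countBelow-bijection f inj k (ℕ.<⇒≤ k<n)) multiplicity≡1 ⟩
    k + 1
      ≡⟨ ℕ.+-comm k 1 ⟩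
    suc k ∎
    where
    open ≡.≡-Reasoning
    multiplicity≡1 : multiplicity f k ≡ 1
    multiplicity≡1 = ≡.subst (λ k → multiplicity f k ≡ 1) (toℕ-fromℕ< k<n)
      (sum≡n⇒all≡1 n (λ v → multiplicity f (toℕ v)) (λ v → multiplicity≤1 f inj (toℕ v)) (sum-multiplicity f) (fromℕ< k<n))

  isInjective-cong : ∀ {n m} {f g : Fin n → Fin m} → f ≗ g → isInjective f ≡ isInjective g
  isInjective-cong {n} f≗g = allPairs-cong n (λ i j → cong₂ (λ u v → not (toℕ u ≡ᵇ toℕ v)) (f≗g i) (f≗g j))

  inversionCount-cong : ∀ {n m} {f g : Fin n → Fin m} → f ≗ g → inversionCount f ≡ inversionCount g
  inversionCount-cong {n} f≗g = sumPairs-cong n (λ i j → cong₂ (λ u v → 𝟙 (toℕ v <ᵇ toℕ u)) (f≗g i) (f≗g j))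

  countBelow-cong : ∀ {n m} {f g : Fin n → Fin m} → f ≗ g → ∀ k → countBelow f k ≡ countBelow g k
  countBelow-cong f≗g k = sumℕ-cong (λ j → cong (λ u → 𝟙 (toℕ u <ᵇ k)) (f≗g j))

  isInjective-punchIn : ∀ {n m} (x : Fin (suc m)) (g : Fin n → Fin m) →
                        isInjective (punchIn x ∘ g) ≡ isInjective g
  isInjective-punchIn {n} x g = allPairs-cong n (λ i j → cong not (punchIn-≡ᵇ x (g i) (g j)))

  inversionCount-punchIn : ∀ {n m} (x : Fin (suc m)) (g : Fin n → Fin m) →
                           inversionCount (punchIn x ∘ g) ≡ inversionCount g
  inversionCount-punchIn {n} x g = sumPairs-cong n (λ i j → cong 𝟙 (punchIn-<ᵇ x (g j) (g i)))

  countBelow-punchIn-pivot : ∀ {n m} (x : Fin (suc m)) (g : Fin n → Fin m) →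
                             countBelow (punchIn x ∘ g) (toℕ x) ≡ countBelow g (toℕ x)
  countBelow-punchIn-pivot x g = sumℕ-cong (λ j → cong 𝟙 (punchIn-<ᵇ-pivot x (g j)))

open Injections

∷-cong : ∀ {a} {A : Set a} {n} (y : A) {f g : Fin n → A} → f ≗ g → (y ∷ f) ≗ (y ∷ g)
∷-cong y f≗g fzero    = ≡.refl
∷-cong y f≗g (fsuc i) = f≗g i

-- punchOut without the inequality proof; the value on the diagonal is junk.
punchOut′ : ∀ {n} → Fin (suc (suc n)) → Fin (suc (suc n)) → Fin (suc n)
punchOut′         fzero    fzero    = fzero
punchOut′         fzero    (fsuc j) = j
punchOut′         (fsuc i) fzero    = fzero
punchOut′ {zero}  (fsuc i) (fsuc j) = fzero
punchOut′ {suc n} (fsuc i) (fsuc j) = fsuc (punchOut′ i j)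

punchOut′-punchIn : ∀ {n} (x : Fin (suc (suc n))) (j : Fin (suc n)) → punchOut′ x (punchIn x j) ≡ j
punchOut′-punchIn         fzero    j        = ≡.refl
punchOut′-punchIn         (fsuc x) fzero    = ≡.refl
punchOut′-punchIn {suc n} (fsuc x) (fsuc j) = ≡.cong fsuc (punchOut′-punchIn x j)

punchIn-punchIn-comm : ∀ {n} (y : Fin (suc (suc n))) (j : Fin (suc n)) (c : Fin n) →
  punchIn (punchIn y j) (punchIn (punchOut′ (punchIn y j) y) c) ≡ punchIn y (punchIn j c)
punchIn-punchIn-comm         fzero    j        c        = ≡.refl
punchIn-punchIn-comm         (fsuc y) fzero    c        = ≡.refl
punchIn-punchIn-comm {suc n} (fsuc y) (fsuc j) fzero    = ≡.refl
punchIn-punchIn-comm {suc n} (fsuc y) (fsuc j) (fsuc c) = ≡.cong fsuc (punchIn-punchIn-comm y j c)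

module FiniteSums {c ℓ} (R : CommutativeRing c ℓ) where
  open CommutativeRing R
  open import Algebra.Properties.Semiring.Sum semiring
  open import Algebra.Properties.AbelianGroup +-abelianGroup using () renaming (∙-cancelˡ to +-cancelˡ)
  open import Relation.Binary.Reasoning.Setoid setoid
  open ListFolds +-monoid using () renaming (fold-map-cong to sumR-map-cong; fold-concatMap to sumR-concatMap; fold-allFin to sumR-allFin)

  when : Bool → Carrier → Carrier
  when b v = if b then v else 0#

  when-cong : ∀ b {u v} → u ≈ v → when b u ≈ when b v
  when-cong true  u≈v = u≈v
  when-cong false u≈v = refl

  when-∧ : ∀ a b v → when (a ∧ b) v ≡ when a (when b v)
  when-∧ true  b v = ≡.refl
  when-∧ false b v = ≡.refl

  when-comm : ∀ a b v → when a (when b v) ≡ when b (when a v)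
  when-comm true  b     v = ≡.refl
  when-comm false true  v = ≡.refl
  when-comm false false v = ≡.refl

  ∑-when : ∀ n a (F : Fin n → Carrier) → ∑[ y < n ] when a (F y) ≈ when a (∑[ y < n ] F y)
  ∑-when n true  F = refl
  ∑-when n false F = sum-replicate-zero n

  ∑-avoiding : ∀ m (x : Fin (suc m)) (F : Fin (suc m) → Carrier) →
               ∑[ y < suc m ] when (not (toℕ x ≡ᵇ toℕ y)) (F y) ≈ ∑[ y < m ] F (punchIn x y)
  ∑-avoiding m       fzero    F = +-identityˡ _
  ∑-avoiding (suc m) (fsuc x) F = +-congˡ (∑-avoiding m x (F ∘ fsuc))

  ∑-*-∑-comm : ∀ m k (f : Fin m → Carrier) (g : Fin m → Fin k → Carrier) →
               ∑[ x < m ] (f x * ∑[ i < k ] g x i) ≈ ∑[ i < k ] ∑[ x < m ] (f x * g x i)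
  ∑-*-∑-comm m k f g = trans (sum-cong-≋ {m} (λ x → *-distribˡ-sum (f x) (g x))) (∑-comm (λ x i → f x * g x i))

  *-distribˡ-∑∑ : ∀ m n k (s : Fin m → Carrier) (t : Fin m → Fin n → Carrier) →
                  k * ∑[ i < m ] (s i * ∑[ x < n ] t i x) ≈ ∑[ i < m ] ∑[ x < n ] (k * (s i * t i x))
  *-distribˡ-∑∑ m n k s t = trans (*-distribˡ-sum k (λ i → s i * ∑[ x < n ] t i x)) (sum-cong-≋ {m} (λ i →
    trans (*-congˡ {k} (*-distribˡ-sum (s i) (t i))) (*-distribˡ-sum k (λ x → s i * t i x))))

  -- Both sides enumerate the ordered pairs of distinct indices: add the diagonal and compare with ∑-comm.
  ∑-distinct-pairs : ∀ m (H : Fin (suc m) → Fin (suc m) → Carrier) →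
    ∑[ x < suc m ] ∑[ j < m ] H x (punchIn x j) ≈ ∑[ y < suc m ] ∑[ j < m ] H (punchIn y j) y
  ∑-distinct-pairs m H = +-cancelˡ diagonal _ _ (begin
    diagonal + ∑[ x < suc m ] ∑[ j < m ] H x (punchIn x j)
      ≈⟨ sym (∑-distrib-+ (λ x → H x x) (λ x → ∑[ j < m ] H x (punchIn x j))) ⟩
    ∑[ x < suc m ] (H x x + ∑[ j < m ] H x (punchIn x j))
      ≈⟨ sum-cong-≋ {suc m} (λ x → sym (sum-remove {i = x} (H x))) ⟩
    ∑[ x < suc m ] ∑[ y < suc m ] H x y
      ≈⟨ ∑-comm H ⟩
    ∑[ y < suc m ] ∑[ x < suc m ] H x y
      ≈⟨ sum-cong-≋ {suc m} (λ y → sum-remove {i = y} (λ x → H x y)) ⟩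
    ∑[ y < suc m ] (H y y + ∑[ j < m ] H (punchIn y j) y)
      ≈⟨ ∑-distrib-+ (λ y → H y y) (λ y → ∑[ j < m ] H (punchIn y j) y) ⟩
    diagonal + ∑[ y < suc m ] ∑[ j < m ] H (punchIn y j) y ∎)
    where
    diagonal = ∑[ x < suc m ] H x x

  ∑fun : ∀ n m → ((Fin n → Fin m) → Carrier) → Carrier
  ∑fun zero    m Φ = Φ (λ ())
  ∑fun (suc n) m Φ = ∑fun n m (λ f → ∑[ x < m ] Φ (x ∷ f))

  Extensional : ∀ {n m} → ((Fin n → Fin m) → Carrier) → Set ℓ
  Extensional Φ = ∀ {f g} → f ≗ g → Φ f ≈ Φ g

  ∑fun-cong : ∀ n m {Φ Ψ : (Fin n → Fin m) → Carrier} → (∀ f → Φ f ≈ Ψ f) → ∑fun n m Φ ≈ ∑fun n m Ψ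
  ∑fun-cong zero    m Φ≈Ψ = Φ≈Ψ _
  ∑fun-cong (suc n) m Φ≈Ψ = ∑fun-cong n m (λ f → sum-cong-≋ (λ x → Φ≈Ψ (x ∷ f)))

  ∑fun-distribˡ : ∀ n m a (Φ : (Fin n → Fin m) → Carrier) → a * ∑fun n m Φ ≈ ∑fun n m (λ f → a * Φ f)
  ∑fun-distribˡ zero    m a Φ = refl
  ∑fun-distribˡ (suc n) m a Φ =
    trans (∑fun-distribˡ n m a _) (∑fun-cong n m (λ f → *-distribˡ-sum a (λ x → Φ (x ∷ f))))

  ∑fun-comm : ∀ n m k (F : (Fin n → Fin m) → Fin k → Carrier) →
              ∑fun n m (λ f → ∑[ x < k ] F f x) ≈ ∑[ x < k ] ∑fun n m (λ f → F f x)
  ∑fun-comm zero    m k F = refl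
  ∑fun-comm (suc n) m k F =
    trans (∑fun-cong n m (λ f → ∑-comm (λ y x → F (y ∷ f) x))) (∑fun-comm n m k _)

  ∑fun-avoiding : ∀ n m (x : Fin (suc m)) (Φ : (Fin n → Fin (suc m)) → Carrier) → Extensional Φ →
                  ∑fun n (suc m) (λ f → when (avoids x f) (Φ f)) ≈ ∑fun n m (λ g → Φ (punchIn x ∘ g))
  ∑fun-avoiding zero    m x Φ Φ-ext = Φ-ext (λ ())
  ∑fun-avoiding (suc n) m x Φ Φ-ext = begin
    ∑fun n (suc m) (λ f → ∑[ y < suc m ] when (not (toℕ x ≡ᵇ toℕ y) ∧ avoids x f) (Φ (y ∷ f)))
      ≈⟨ ∑fun-cong n (suc m) pull-out-avoids ⟩
    ∑fun n (suc m) (λ f → when (avoids x f) (Ψ f))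
      ≈⟨ ∑fun-avoiding n m x Ψ Ψ-ext ⟩
    ∑fun n m (λ g → Ψ (punchIn x ∘ g))
      ≈⟨ ∑fun-cong n m (λ g → trans (∑-avoiding m x (λ y → Φ (y ∷ (punchIn x ∘ g))))
                                     (sum-cong-≋ {m} (λ y → Φ-ext (punchIn-∷ y g)))) ⟩
    ∑fun (suc n) m (λ g → Φ (punchIn x ∘ g)) ∎
    where
    Ψ : (Fin n → Fin (suc m)) → Carrier
    Ψ f = ∑[ y < suc m ] when (not (toℕ x ≡ᵇ toℕ y)) (Φ (y ∷ f))
    Ψ-ext : Extensional Ψ
    Ψ-ext f≗g = sum-cong-≋ (λ y → when-cong (not (toℕ x ≡ᵇ toℕ y)) (Φ-ext (∷-cong y f≗g)))
    pull-out-avoids : ∀ f → ∑[ y < suc m ] when (not (toℕ x ≡ᵇ toℕ y) ∧ avoids x f) (Φ (y ∷ f))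
                            ≈ when (avoids x f) (Ψ f)
    pull-out-avoids f = begin
      ∑[ y < suc m ] when (not (toℕ x ≡ᵇ toℕ y) ∧ avoids x f) (Φ (y ∷ f))
        ≡⟨ sum-cong-≗ {suc m} (λ y → ≡.trans (when-∧ (not (toℕ x ≡ᵇ toℕ y)) (avoids x f) (Φ (y ∷ f)))
                                                (when-comm (not (toℕ x ≡ᵇ toℕ y)) (avoids x f) (Φ (y ∷ f)))) ⟩
      ∑[ y < suc m ] when (avoids x f) (when (not (toℕ x ≡ᵇ toℕ y)) (Φ (y ∷ f)))
        ≈⟨ ∑-when (suc m) (avoids x f) (λ y → when (not (toℕ x ≡ᵇ toℕ y)) (Φ (y ∷ f))) ⟩
      when (avoids x f) (Ψ f) ∎
    punchIn-∷ : ∀ (y : Fin m) (g : Fin n → Fin m) → (punchIn x y ∷ (punchIn x ∘ g)) ≗ (punchIn x ∘ (y ∷ g))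
    punchIn-∷ y g fzero    = ≡.refl
    punchIn-∷ y g (fsuc i) = ≡.refl

  sumR-allFuns : ∀ n m (Φ : (Fin n → Fin m) → Carrier) → sumR R (map Φ (allFuns n m)) ≈ ∑fun n m Φ
  sumR-allFuns zero    m Φ = +-identityʳ _
  sumR-allFuns (suc n) m Φ = begin
    sumR R (map Φ (concatMap extend (allFuns n m)))
      ≡⟨ ≡.cong (sumR R) (map-concatMap Φ extend (allFuns n m)) ⟩
    sumR R (concatMap (map Φ ∘ extend) (allFuns n m))
      ≈⟨ sumR-concatMap (map Φ ∘ extend) (allFuns n m) ⟩
    sumR R (map (λ f → sumR R (map Φ (extend f))) (allFuns n m))
      ≈⟨ sumR-map-cong (allFuns n m) (λ f → trans (reflexive (≡.cong (sumR R) (≡.sym (map-∘ (allFin m))))) (sumR-allFin m _)) ⟩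
    sumR R (map (λ f → ∑[ x < m ] Φ (x ∷ f)) (allFuns n m))
      ≈⟨ sumR-allFuns n m _ ⟩
    ∑fun (suc n) m Φ ∎
    where
    extend : (Fin n → Fin m) → List (Fin (suc n) → Fin m)
    extend f = map (_∷ f) (allFin m)

module QPermanent {c ℓ} (R : CommutativeRing c ℓ) where
  open CommutativeRing R
  open FiniteSums R
  open import Algebra.Properties.Semiring.Sum semiring
  open import Algebra.Properties.Semiring.Exp semiring using (_^_; ^-homo-*; ^-congˡ)
  open import Algebra.Properties.Monoid.Sum *-monoid using () renaming (sum to product; sum-cong-≋ to product-cong)
  open import Algebra.Solver.Ring.NaturalCoefficients.Default commutativeSemiring using (solve; _:*_; _:=_; con)
  open import Algebra.Properties.Ring ring using (-1*x≈-x; -‿involutive)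
  open import Relation.Binary.Reasoning.Setoid setoid
  open ListFolds *-monoid using () renaming (fold-allFin to prodFin≈product)

  Matrix : ℕ → Set c
  Matrix n = Fin n → Fin n → Carrier

  minor : ∀ {n} → Fin (suc n) → Fin (suc n) → Matrix (suc n) → Matrix n
  minor i j M r c = M (punchIn i r) (punchIn j c)

  -- The q-permanent ∑_σ q ^ inv(σ) ∏_i M i (σ i) (q = 1: permanent, q = -1: determinant),
  -- defined by expansion along the first row.
  qPer : Carrier → (n : ℕ) → Matrix n → Carrier
  qPer q zero    M = 1#
  qPer q (suc n) M = ∑[ x < suc n ] (q ^ toℕ x * M fzero x * qPer q n (minor fzero x M))

  qPer-cong : ∀ q n {M N : Matrix n} → (∀ i j → M i j ≈ N i j) → qPer q n M ≈ qPer q n N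
  qPer-cong q zero    M≈N = refl
  qPer-cong q (suc n) M≈N = sum-cong-≋ {suc n} (λ x →
    *-cong (*-congˡ {q ^ toℕ x} (M≈N fzero x)) (qPer-cong q n (λ i j → M≈N (punchIn fzero i) (punchIn x j))))

  qPer-congˡ : ∀ {q q′} n (M : Matrix n) → q ≈ q′ → qPer q n M ≈ qPer q′ n M
  qPer-congˡ zero    M q≈q′ = refl
  qPer-congˡ (suc n) M q≈q′ = sum-cong-≋ {suc n} (λ x →
    *-cong (*-congʳ {M fzero x} (^-congˡ (toℕ x) q≈q′)) (qPer-congˡ n (minor fzero x M) q≈q′))

  qPer-cong-≗ : ∀ q n {M N : Matrix n} → M ≗ N → qPer q n M ≈ qPer q n N
  qPer-cong-≗ q n M≗N = qPer-cong q n (λ i j → reflexive (≡.cong-app (M≗N i) j))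

  qPerLeibniz : Carrier → (n : ℕ) → Matrix n → Carrier
  qPerLeibniz q n M =
    ∑fun n n (λ σ → when (isInjective σ) (q ^ inversionCount σ * product (λ i → M i (σ i))))

  -- A bijection σ with σ 0 = x has exactly toℕ x inversions involving 0 (countBelow-bijection).
  qPerLeibniz-expand : ∀ q n (M : Matrix (suc n)) →
    qPerLeibniz q (suc n) M ≈ ∑[ x < suc n ] (q ^ toℕ x * M fzero x * qPerLeibniz q n (minor fzero x M))
  qPerLeibniz-expand q n M = begin
    ∑fun n (suc n) (λ f → ∑[ x < suc n ] when (avoids x f ∧ isInjective f) (weight x f))
      ≈⟨ ∑fun-cong n (suc n) (λ f → reflexive (sum-cong-≗ {suc n} (λ x → when-∧ (avoids x f) (isInjective f) (weight x f)))) ⟩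
    ∑fun n (suc n) (λ f → ∑[ x < suc n ] when (avoids x f) (T x f))
      ≈⟨ ∑fun-comm n (suc n) (suc n) (λ f x → when (avoids x f) (T x f)) ⟩
    ∑[ x < suc n ] ∑fun n (suc n) (λ f → when (avoids x f) (T x f))
      ≈⟨ sum-cong-≋ {suc n} (λ x → ∑fun-avoiding n n x (T x) (T-ext x)) ⟩
    ∑[ x < suc n ] ∑fun n n (λ g → T x (punchIn x ∘ g))
      ≈⟨ sum-cong-≋ {suc n} (λ x → ∑fun-cong n n (T-punchIn x)) ⟩
    ∑[ x < suc n ] ∑fun n n (λ g → (q ^ toℕ x * M fzero x) * L x g)
      ≈⟨ sum-cong-≋ {suc n} (λ x → sym (∑fun-distribˡ n n (q ^ toℕ x * M fzero x) (L x))) ⟩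
    ∑[ x < suc n ] (q ^ toℕ x * M fzero x * qPerLeibniz q n (minor fzero x M)) ∎
    where
    weight : Fin (suc n) → (Fin n → Fin (suc n)) → Carrier
    weight x f = q ^ (countBelow f (toℕ x) ℕ+ inversionCount f) * (M fzero x * product (λ i → M (fsuc i) (f i)))
    T : Fin (suc n) → (Fin n → Fin (suc n)) → Carrier
    T x f = when (isInjective f) (weight x f)
    L : Fin (suc n) → (Fin n → Fin n) → Carrier
    L x g = when (isInjective g) (q ^ inversionCount g * product (λ i → minor fzero x M i (g i)))
    T-ext : ∀ x → Extensional (T x)
    T-ext x {f} {g} f≗g
      rewrite isInjective-cong f≗g | countBelow-cong f≗g (toℕ x) | inversionCount-cong f≗g =
      when-cong (isInjective g) (*-congˡ (*-congˡ (product-cong {n} (λ i → reflexive (≡.cong (M (fsuc i)) (f≗g i))))))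
    T-punchIn : ∀ x g → T x (punchIn x ∘ g) ≈ (q ^ toℕ x * M fzero x) * L x g
    T-punchIn x g
      rewrite isInjective-punchIn x g | countBelow-punchIn-pivot x g | inversionCount-punchIn x g
      with isInjective g in inj
    ... | false = sym (zeroʳ _)
    ... | true  rewrite countBelow-bijection g inj (toℕ x) (toℕ≤pred[n] x) = begin
      q ^ (toℕ x ℕ+ inversionCount g) * (M fzero x * P)     ≈⟨ *-congʳ (^-homo-* q (toℕ x) (inversionCount g)) ⟩
      (q ^ toℕ x * q ^ inversionCount g) * (M fzero x * P)   ≈⟨ solve 4 (λ a b m p → (a :* b :* (m :* p)) := (a :* m :* (b :* p))) refl _ _ _ _ ⟩
      (q ^ toℕ x * M fzero x) * (q ^ inversionCount g * P)   ∎
      where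
      P = product (λ i → M (fsuc i) (punchIn x (g i)))

  qPerLeibniz≈qPer : ∀ q n (M : Matrix n) → qPerLeibniz q n M ≈ qPer q n M
  qPerLeibniz≈qPer q zero    M = *-identityˡ 1#
  qPerLeibniz≈qPer q (suc n) M = trans (qPerLeibniz-expand q n M)
    (sum-cong-≋ {suc n} (λ x → *-congˡ {q ^ toℕ x * M fzero x} (qPerLeibniz≈qPer q n (minor fzero x M))))

  ^-zeroˡ : ∀ k → 1# ^ k ≈ 1#
  ^-zeroˡ zero    = refl
  ^-zeroˡ (suc k) = trans (*-identityˡ (1# ^ k)) (^-zeroˡ k)

  negOnePow≈^ : ∀ k → negOnePow R k ≈ (- 1#) ^ k
  negOnePow≈^ zero = refl
  negOnePow≈^ (suc k) with isEven k | negOnePow≈^ k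
  ... | true  | 1≈ = sym (trans (*-congˡ (sym 1≈)) (*-identityʳ _))
  ... | false | -1≈ = sym (trans (*-congˡ (sym -1≈)) (trans (-1*x≈-x (- 1#)) (-‿involutive 1#)))

  per≈qPer : ∀ n (M : Matrix n) → per R n M ≈ qPer 1# n M
  per≈qPer n M = begin
    per R n M                 ≈⟨ sumR-allFuns n n _ ⟩
    ∑fun n n (λ σ → if isPerm σ then prodFin R n (λ i → M i (σ i)) else 0#)
      ≈⟨ ∑fun-cong n n term ⟩
    qPerLeibniz 1# n M        ≈⟨ qPerLeibniz≈qPer 1# n M ⟩
    qPer 1# n M ∎
    where
    term : ∀ σ → (if isPerm σ then prodFin R n (λ i → M i (σ i)) else 0#)
               ≈ when (isInjective σ) (1# ^ inversionCount σ * product (λ i → M i (σ i)))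
    term σ rewrite isPerm≡isInjective σ = when-cong (isInjective σ)
      (trans (prodFin≈product n (λ i → M i (σ i))) (sym (trans (*-congʳ (^-zeroˡ (inversionCount σ))) (*-identityˡ _))))

  det≈qPer : ∀ n (M : Matrix n) → det R n M ≈ qPer (- 1#) n M
  det≈qPer n M = begin
    det R n M                 ≈⟨ sumR-allFuns n n _ ⟩
    ∑fun n n (λ σ → if isPerm σ then sgn R σ * prodFin R n (λ i → M i (σ i)) else 0#)
      ≈⟨ ∑fun-cong n n term ⟩
    qPerLeibniz (- 1#) n M    ≈⟨ qPerLeibniz≈qPer (- 1#) n M ⟩
    qPer (- 1#) n M ∎
    where
    term : ∀ σ → (if isPerm σ then sgn R σ * prodFin R n (λ i → M i (σ i)) else 0#)
               ≈ when (isInjective σ) ((- 1#) ^ inversionCount σ * product (λ i → M i (σ i)))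
    term σ rewrite isPerm≡isInjective σ | ≡.sym (inversions≡inversionCount σ) = when-cong (isInjective σ)
      (*-cong (negOnePow≈^ (inversions σ)) (prodFin≈product n (λ i → M i (σ i))))

  qPer-expand-column : ∀ q n (M : Matrix (suc n)) →
    qPer q (suc n) M ≈ ∑[ i < suc n ] (q ^ toℕ i * M i fzero * qPer q n (minor i fzero M))
  qPer-expand-column q zero    M = refl
  qPer-expand-column q (suc n) M = +-congˡ (begin
    ∑[ x < suc n ] (a x * qPer q (suc n) (minor fzero (fsuc x) M))
      ≈⟨ sum-cong-≋ {suc n} (λ x → *-congˡ {a x} (qPer-expand-column q n (minor fzero (fsuc x) M))) ⟩
    ∑[ x < suc n ] (a x * ∑[ i < suc n ] (b i * C x i))
      ≈⟨ ∑-*-∑-comm (suc n) (suc n) a (λ x i → b i * C x i) ⟩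
    ∑[ i < suc n ] ∑[ x < suc n ] (a x * (b i * C x i))
      ≈⟨ sum-cong-≋ {suc n} (λ i → sum-cong-≋ {suc n} (λ x →
           swap-scalars (q ^ toℕ x) (M fzero (fsuc x)) (q ^ toℕ i) (M (fsuc i) fzero) (C x i))) ⟩
    ∑[ i < suc n ] ∑[ x < suc n ] (b′ i * (q ^ toℕ x * M fzero (fsuc x) * C x i))
      ≈⟨ sum-cong-≋ {suc n} (λ i → sym (*-distribˡ-sum (b′ i) (λ x → q ^ toℕ x * M fzero (fsuc x) * C x i))) ⟩
    ∑[ i < suc n ] (b′ i * qPer q (suc n) (minor (fsuc i) fzero M)) ∎)
    where
    a b b′ : Fin (suc n) → Carrier
    a x  = q ^ toℕ (fsuc x) * M fzero (fsuc x)
    b i  = q ^ toℕ i * M (fsuc i) fzero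
    b′ i = q ^ toℕ (fsuc i) * M (fsuc i) fzero
    C : Fin (suc n) → Fin (suc n) → Carrier
    C x i = qPer q n (λ r c → M (fsuc (punchIn i r)) (fsuc (punchIn x c)))
    swap-scalars : ∀ u m v m′ p → q * u * m * (v * m′ * p) ≈ q * v * m′ * (u * m * p)
    swap-scalars = solve 6 (λ q u m v m′ p → (q :* u :* m :* (v :* m′ :* p)) := (q :* v :* m′ :* (u :* m :* p))) refl q

  swap-sign : ∀ q → q * q ≈ 1# → ∀ {n} (y : Fin (suc (suc n))) (j : Fin (suc n)) →
    q ^ toℕ (punchIn y j) * q ^ toℕ (punchOut′ (punchIn y j) y) ≈ q * (q ^ toℕ y * q ^ toℕ j)
  swap-sign q qq≈1         fzero    j        = solve 2 (λ q u → (q :* u :* con 1) := (q :* (con 1 :* u))) refl q (q ^ toℕ j)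
  swap-sign q qq≈1         (fsuc y) fzero    = begin
    1# * q ^ toℕ y           ≈⟨ *-congʳ (sym qq≈1) ⟩
    q * q * q ^ toℕ y        ≈⟨ solve 2 (λ q u → (q :* q :* u) := (q :* (q :* u :* con 1))) refl q (q ^ toℕ y) ⟩
    q * (q * q ^ toℕ y * 1#) ∎
  swap-sign q qq≈1 {suc n} (fsuc y) (fsuc j) = begin
    q * q ^ toℕ (punchIn y j) * (q * q ^ toℕ (punchOut′ (punchIn y j) y))
      ≈⟨ solve 3 (λ q u v → (q :* u :* (q :* v)) := (q :* q :* (u :* v))) refl q _ _ ⟩
    q * q * (q ^ toℕ (punchIn y j) * q ^ toℕ (punchOut′ (punchIn y j) y))
      ≈⟨ *-congˡ {q * q} (swap-sign q qq≈1 y j) ⟩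
    q * q * (q * (q ^ toℕ y * q ^ toℕ j))
      ≈⟨ solve 3 (λ q u v → (q :* q :* (q :* (u :* v))) := (q :* (q :* u :* (q :* v)))) refl q _ _ ⟩
    q * (q * q ^ toℕ y * (q * q ^ toℕ j)) ∎

  qPer-swap : ∀ q → q * q ≈ 1# → ∀ n (u v : Fin (suc (suc n)) → Carrier) (K : Fin n → Fin (suc (suc n)) → Carrier) →
              qPer q (suc (suc n)) (u ∷ v ∷ K) ≈ q * qPer q (suc (suc n)) (v ∷ u ∷ K)
  qPer-swap q qq≈1 n u v K = begin
    ∑[ x < suc (suc n) ] (q ^ toℕ x * u x * ∑[ j < suc n ] (q ^ toℕ j * v (punchIn x j) * without x j))
      ≈⟨ sum-cong-≋ {suc (suc n)} (λ x → *-distribˡ-sum (q ^ toℕ x * u x) (λ j → q ^ toℕ j * v (punchIn x j) * without x j)) ⟩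
    ∑[ x < suc (suc n) ] ∑[ j < suc n ] (q ^ toℕ x * u x * (q ^ toℕ j * v (punchIn x j) * without x j))
      ≡⟨ sum-cong-≗ {suc (suc n)} (λ x → sum-cong-≗ {suc n} (λ j →
           ≡.cong (λ k → q ^ toℕ x * u x * (q ^ toℕ k * v (punchIn x j) * without x k)) (≡.sym (punchOut′-punchIn x j)))) ⟩
    ∑[ x < suc (suc n) ] ∑[ j < suc n ] H x (punchIn x j)
      ≈⟨ ∑-distinct-pairs (suc n) H ⟩
    ∑[ y < suc (suc n) ] ∑[ j < suc n ] H (punchIn y j) y
      ≈⟨ sum-cong-≋ {suc (suc n)} (λ y → sum-cong-≋ {suc n} (λ j → H-swapped y j)) ⟩
    ∑[ y < suc (suc n) ] ∑[ j < suc n ] (q * (q ^ toℕ y * v y * (q ^ toℕ j * u (punchIn y j) * without y j)))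
      ≈⟨ sym (*-distribˡ-∑∑ (suc (suc n)) (suc n) q (λ y → q ^ toℕ y * v y) (λ y j → q ^ toℕ j * u (punchIn y j) * without y j)) ⟩
    q * ∑[ y < suc (suc n) ] (q ^ toℕ y * v y * ∑[ j < suc n ] (q ^ toℕ j * u (punchIn y j) * without y j)) ∎
    where
    without : Fin (suc (suc n)) → Fin (suc n) → Carrier
    without x j = qPer q n (λ r c → K r (punchIn x (punchIn j c)))
    H : Fin (suc (suc n)) → Fin (suc (suc n)) → Carrier
    H x y = q ^ toℕ x * u x * (q ^ toℕ (punchOut′ x y) * v y * without x (punchOut′ x y))
    H-swapped : ∀ y j → H (punchIn y j) y ≈ q * (q ^ toℕ y * v y * (q ^ toℕ j * u (punchIn y j) * without y j))
    H-swapped y j = begin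
      q ^ toℕ x * u x * (q ^ toℕ k * v y * without x k)
        ≈⟨ *-congˡ {q ^ toℕ x * u x} (*-congˡ {q ^ toℕ k * v y}
             (qPer-cong q n (λ r c → reflexive (≡.cong (K r) (punchIn-punchIn-comm y j c))))) ⟩
      q ^ toℕ x * u x * (q ^ toℕ k * v y * without y j)
        ≈⟨ solve 5 (λ a u b v w → (a :* u :* (b :* v :* w)) := (a :* b :* (v :* (u :* w)))) refl _ _ _ _ _ ⟩
      q ^ toℕ x * q ^ toℕ k * (v y * (u x * without y j))
        ≈⟨ *-congʳ (swap-sign q qq≈1 y j) ⟩
      q * (q ^ toℕ y * q ^ toℕ j) * (v y * (u x * without y j))
        ≈⟨ solve 6 (λ q a b v u w → (q :* (a :* b) :* (v :* (u :* w))) := (q :* (a :* v :* (b :* u :* w)))) refl q _ _ _ _ _ ⟩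
      q * (q ^ toℕ y * v y * (q ^ toℕ j * u x * without y j)) ∎
      where
      x = punchIn y j
      k = punchOut′ x y

-- R[ε] with ε² = 0; a pair (x , x′) stands for x + x′ε.
dualNumbers : ∀ {c ℓ} → CommutativeRing c ℓ → CommutativeRing c ℓ
dualNumbers R = record
  { Carrier = Carrier × Carrier
  ; _≈_ = Pointwise _≈_ _≈_
  ; _+_ = zip _+_ _+_
  ; _*_ = _*ε_
  ; -_ = map× (-_) (-_)
  ; 0# = 0# , 0#
  ; 1# = 1# , 0#
  ; isCommutativeRing = record
    { isRing = record
      { +-isAbelianGroup = AbelianGroup.isAbelianGroup (DirectProduct.abelianGroup +-abelianGroup +-abelianGroup)
      ; *-cong = λ (x₀ , x₁) (y₀ , y₁) → *-cong x₀ y₀ , +-cong (*-cong x₀ y₁) (*-cong x₁ y₀)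
      ; *-assoc = λ (a , a′) (b , b′) (c , c′) → *-assoc a b c ,
          solve 6 (λ a a′ b b′ c c′ → (a :* b :* c′ :+ (a :* b′ :+ a′ :* b) :* c)
                                    := (a :* (b :* c′ :+ b′ :* c) :+ a′ :* (b :* c))) refl a a′ b b′ c c′
      ; *-identity = (λ (a , a′) → *-identityˡ a , solve 2 (λ a a′ → (con 1 :* a′ :+ con 0 :* a) := a′) refl a a′)
                   , (λ (a , a′) → *-identityʳ a , solve 2 (λ a a′ → (a :* con 0 :+ a′ :* con 1) := a′) refl a a′)
      ; distrib = (λ (a , a′) (b , b′) (c , c′) → distribˡ a b c ,
                     solve 6 (λ a a′ b b′ c c′ → (a :* (b′ :+ c′) :+ a′ :* (b :+ c))
                                               := (a :* b′ :+ a′ :* b :+ (a :* c′ :+ a′ :* c))) refl a a′ b b′ c c′)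
                , (λ (a , a′) (b , b′) (c , c′) → distribʳ a b c ,
                     solve 6 (λ a a′ b b′ c c′ → ((b :+ c) :* a′ :+ (b′ :+ c′) :* a)
                                               := (b :* a′ :+ b′ :* a :+ (c :* a′ :+ c′ :* a))) refl a a′ b b′ c c′)
      }
    ; *-comm = λ (a , a′) (b , b′) → *-comm a b ,
        solve 4 (λ a a′ b b′ → (a :* b′ :+ a′ :* b) := (b :* a′ :+ b′ :* a)) refl a a′ b b′
    }
  }
  where
  open CommutativeRing R
  open import Algebra.Solver.Ring.NaturalCoefficients.Default commutativeSemiring using (solve; _:+_; _:*_; _:=_; con)
  _*ε_ : Carrier × Carrier → Carrier × Carrier → Carrier × Carrier
  (a , a′) *ε (b , b′) = a * b , a * b′ + a′ * b

module Jacobi {c ℓ} (R : CommutativeRing c ℓ) where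
  open CommutativeRing R
  open FiniteSums R using (∑-*-∑-comm)
  open QPermanent R
  module ε where
    open CommutativeRing (dualNumbers R) public using (_*_)
    open QPermanent (dualNumbers R) public
  open import Algebra.Properties.Semiring.Sum semiring
  open import Algebra.Properties.Semiring.Exp semiring using (_^_)
  open import Algebra.Properties.Semiring.Sum (CommutativeRing.semiring (dualNumbers R)) using ()
    renaming (sum to sumε)
  open import Algebra.Properties.Semiring.Exp (CommutativeRing.semiring (dualNumbers R)) using ()
    renaming (_^_ to _^ε_)
  open import Algebra.Solver.Ring.NaturalCoefficients.Default commutativeSemiring using (solve; _:+_; _:*_; _:=_; con)
  open import Relation.Binary.Reasoning.Setoid setoid

  scalar : Carrier → Carrier × Carrier
  scalar q = q , 0#

  proj₁-sum : ∀ n (f : Fin n → Carrier × Carrier) → proj₁ (sumε f) ≡ sum (proj₁ ∘ f)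
  proj₁-sum zero    f = ≡.refl
  proj₁-sum (suc n) f = ≡.cong (proj₁ (f fzero) +_) (proj₁-sum n (f ∘ fsuc))

  proj₂-sum : ∀ n (f : Fin n → Carrier × Carrier) → proj₂ (sumε f) ≡ sum (proj₂ ∘ f)
  proj₂-sum zero    f = ≡.refl
  proj₂-sum (suc n) f = ≡.cong (proj₂ (f fzero) +_) (proj₂-sum n (f ∘ fsuc))

  proj₁-^ : ∀ s k → proj₁ (s ^ε k) ≡ proj₁ s ^ k
  proj₁-^ s zero    = ≡.refl
  proj₁-^ s (suc k) = ≡.cong (proj₁ s *_) (proj₁-^ s k)

  proj₂-scalar-^ : ∀ q k → proj₂ (scalar q ^ε k) ≈ 0#
  proj₂-scalar-^ q zero    = refl
  proj₂-scalar-^ q (suc k) = begin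
    q * proj₂ (scalar q ^ε k) + 0# * proj₁ (scalar q ^ε k) ≈⟨ +-cong (*-congˡ {q} (proj₂-scalar-^ q k)) (zeroˡ _) ⟩
    q * 0# + 0#                                             ≈⟨ trans (+-identityʳ _) (zeroʳ q) ⟩
    0#                                                      ∎

  proj₁-qPer : ∀ s n (M : ε.Matrix n) → proj₁ (ε.qPer s n M) ≈ qPer (proj₁ s) n (λ i j → proj₁ (M i j))
  proj₁-qPer s zero    M = refl
  proj₁-qPer s (suc n) M = trans (reflexive (proj₁-sum (suc n) (λ x → s ^ε toℕ x ε.* M fzero x ε.* ε.qPer s n (ε.minor fzero x M))))
    (sum-cong-≋ {suc n} (λ x → *-cong (*-congʳ {proj₁ (M fzero x)} (reflexive (proj₁-^ s (toℕ x))))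
                                        (proj₁-qPer s n (ε.minor fzero x M))))

  realPart dualPart : ∀ {n} → ε.Matrix n → Matrix n
  realPart M i j = proj₁ (M i j)
  dualPart M i j = proj₂ (M i j)

  proj₂-qPer-suc : ∀ q n (M : ε.Matrix (suc n)) →
    proj₂ (ε.qPer (scalar q) (suc n) M)
      ≈ qPer q (suc n) (dualPart M fzero ∷ removeAt (realPart M) fzero)
        + ∑[ x < suc n ] (q ^ toℕ x * realPart M fzero x * proj₂ (ε.qPer (scalar q) n (ε.minor fzero x M)))
  proj₂-qPer-suc q n M = begin
    proj₂ (sumε term)
      ≡⟨ proj₂-sum (suc n) term ⟩
    sum (proj₂ ∘ term)
      ≈⟨ sum-cong-≋ {suc n} product-rule ⟩
    ∑[ x < suc n ] (q ^ toℕ x * dualPart M fzero x * qPer q n (minor fzero x (realPart M))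
                    + q ^ toℕ x * realPart M fzero x * proj₂ (minorε x))
      ≈⟨ ∑-distrib-+ (λ x → q ^ toℕ x * dualPart M fzero x * qPer q n (minor fzero x (realPart M)))
                     (λ x → q ^ toℕ x * realPart M fzero x * proj₂ (minorε x)) ⟩
    _ ∎
    where
    minorε : Fin (suc n) → Carrier × Carrier
    minorε x = ε.qPer (scalar q) n (ε.minor fzero x M)
    term : Fin (suc n) → Carrier × Carrier
    term x = scalar q ^ε toℕ x ε.* M fzero x ε.* minorε x
    product-rule : ∀ x → proj₂ (term x) ≈ q ^ toℕ x * dualPart M fzero x * qPer q n (minor fzero x (realPart M))
                                          + q ^ toℕ x * realPart M fzero x * proj₂ (minorε x)
    product-rule x = begin
      proj₁ (scalar q ^ε k) * a * proj₂ (minorε x) + (proj₁ (scalar q ^ε k) * e + proj₂ (scalar q ^ε k) * a) * proj₁ (minorε x)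
        ≈⟨ +-cong (*-congʳ (*-congʳ (reflexive (proj₁-^ (scalar q) k))))
                  (*-cong (+-cong (*-congʳ (reflexive (proj₁-^ (scalar q) k))) (*-congʳ (proj₂-scalar-^ q k)))
                          (proj₁-qPer (scalar q) n (ε.minor fzero x M))) ⟩
      q ^ k * a * proj₂ (minorε x) + (q ^ k * e + 0# * a) * qPer q n (minor fzero x (realPart M))
        ≈⟨ solve 5 (λ u a e p r → (u :* a :* p :+ (u :* e :+ con 0 :* a) :* r) := (u :* e :* r :+ u :* a :* p)) refl _ _ _ _ _ ⟩
      q ^ k * e * qPer q n (minor fzero x (realPart M)) + q ^ k * a * proj₂ (minorε x) ∎
      where
      k = toℕ x
      a = realPart M fzero x
      e = dualPart M fzero x

  -- Jacobi's formula. Expanding along the first row, the terms carrying E in row i + 1 form a two-row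
  -- expansion with rows A 0 and E (i + 1); qPer-swap moves E (i + 1) to the top.
  proj₂-qPer : ∀ q → q * q ≈ 1# → ∀ n (M : ε.Matrix (suc n)) →
    proj₂ (ε.qPer (scalar q) (suc n) M)
      ≈ ∑[ i < suc n ] (q ^ toℕ i * qPer q (suc n) (dualPart M i ∷ removeAt (realPart M) i))
  proj₂-qPer q qq≈1 zero M = trans (proj₂-qPer-suc q 0 M)
    (solve 2 (λ X u → (X :+ (u :* con 0 :+ con 0)) := (con 1 :* X :+ con 0)) refl _ _)
  proj₂-qPer q qq≈1 (suc n) M = trans (proj₂-qPer-suc q (suc n) M) (+-cong (sym (*-identityˡ _)) (begin
    ∑[ x < suc (suc n) ] (q ^ toℕ x * A fzero x * proj₂ (ε.qPer (scalar q) (suc n) (ε.minor fzero x M)))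
      ≈⟨ sum-cong-≋ {suc (suc n)} (λ x → *-congˡ {q ^ toℕ x * A fzero x} (proj₂-qPer q qq≈1 n (ε.minor fzero x M))) ⟩
    ∑[ x < suc (suc n) ] (q ^ toℕ x * A fzero x * ∑[ i < suc n ] (q ^ toℕ i * cofactor x i))
      ≈⟨ ∑-*-∑-comm (suc (suc n)) (suc n) (λ x → q ^ toℕ x * A fzero x) (λ x i → q ^ toℕ i * cofactor x i) ⟩
    ∑[ i < suc n ] ∑[ x < suc (suc n) ] (q ^ toℕ x * A fzero x * (q ^ toℕ i * cofactor x i))
      ≈⟨ sum-cong-≋ {suc n} (λ i → trans (sum-cong-≋ {suc (suc n)} (λ x → solve 3 (λ a b c → (a :* (b :* c)) := (b :* (a :* c))) refl
                                                                             (q ^ toℕ x * A fzero x) (q ^ toℕ i) (cofactor x i)))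
                                        (sym (*-distribˡ-sum (q ^ toℕ i) (λ x → q ^ toℕ x * A fzero x * cofactor x i)))) ⟩
    ∑[ i < suc n ] (q ^ toℕ i * ∑[ x < suc (suc n) ] (q ^ toℕ x * A fzero x * cofactor x i))
      ≈⟨ sum-cong-≋ {suc n} (λ i → *-congˡ {q ^ toℕ i} (sum-cong-≋ {suc (suc n)} (λ x →
           *-congˡ {q ^ toℕ x * A fzero x} (qPer-cong-≗ q (suc n) (minor-rows x i))))) ⟩
    ∑[ i < suc n ] (q ^ toℕ i * qPer q (suc (suc n)) (A fzero ∷ E (fsuc i) ∷ removeAt (A ∘ fsuc) i))
      ≈⟨ sum-cong-≋ {suc n} (λ i → *-congˡ {q ^ toℕ i} (qPer-swap q qq≈1 n (A fzero) (E (fsuc i)) (removeAt (A ∘ fsuc) i))) ⟩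
    ∑[ i < suc n ] (q ^ toℕ i * (q * qPer q (suc (suc n)) (E (fsuc i) ∷ A fzero ∷ removeAt (A ∘ fsuc) i)))
      ≈⟨ sum-cong-≋ {suc n} (λ i → trans (sym (*-assoc (q ^ toℕ i) q _))
           (*-cong (*-comm (q ^ toℕ i) q) (qPer-cong-≗ q (suc (suc n)) (∷-cong (E (fsuc i)) (rows-swap i))))) ⟩
    ∑[ i < suc n ] (q ^ toℕ (fsuc i) * qPer q (suc (suc n)) (E (fsuc i) ∷ removeAt A (fsuc i))) ∎))
    where
    A = realPart M
    E = dualPart M
    cofactor : Fin (suc (suc n)) → Fin (suc n) → Carrier
    cofactor x i = qPer q (suc n) (dualPart (ε.minor fzero x M) i ∷ removeAt (minor fzero x A) i)
    minor-rows : ∀ x i → (dualPart (ε.minor fzero x M) i ∷ removeAt (minor fzero x A) i)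
                         ≗ minor fzero x (A fzero ∷ E (fsuc i) ∷ removeAt (A ∘ fsuc) i)
    minor-rows x i fzero    = ≡.refl
    minor-rows x i (fsuc r) = ≡.refl
    rows-swap : ∀ i → (A fzero ∷ removeAt (A ∘ fsuc) i) ≗ removeAt A (fsuc i)
    rows-swap i fzero    = ≡.refl
    rows-swap i (fsuc r) = ≡.refl

module XiRecurrence {ℓ₁ ℓ₂} (R : CommutativeRing ℓ₁ ℓ₂) (a b c : CommutativeRing.Carrier R) where
  open CommutativeRing R
  open FiniteSums R using (∑-*-∑-comm; *-distribˡ-∑∑)
  open QPermanent R
  open Jacobi R public using (module ε; scalar; realPart; dualPart)
  open Jacobi R using (proj₂-qPer)
  open import Algebra.Properties.Semiring.Sum semiring
  open import Algebra.Properties.Semiring.Exp semiring using (_^_)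
  open import Algebra.Solver.Ring.NaturalCoefficients.Default commutativeSemiring using (solve; _:+_; _:*_; _:=_; con)
  open import Relation.Binary.Reasoning.Setoid setoid

  Ξ : (n : ℕ) → Matrix n
  Ξ = Xi R a b c

  Ξε : (n : ℕ) → ε.Matrix n
  Ξε = Xi (dualNumbers R) (a , 1#) (b , 1#) (c , 1#)

  -- The derivative of qPer q n (Ξ n) when a, b and c all move at unit speed.
  δqPerΞ : Carrier → ℕ → Carrier
  δqPerΞ q n = proj₂ (ε.qPer (scalar q) n (Ξε n))

  realPart-Ξε : ∀ n i j → realPart (Ξε n) i j ≡ Ξ n i j
  realPart-Ξε n i j = ≡.trans (if-float proj₁ (toℕ i <ᵇ toℕ j))
    (≡.cong (if toℕ i <ᵇ toℕ j then a else_) (if-float proj₁ (toℕ i ≡ᵇ toℕ j)))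

  dualPart-Ξε : ∀ n i j → dualPart (Ξε n) i j ≡ 1#
  dualPart-Ξε n i j = ≡.trans (if-float proj₂ (toℕ i <ᵇ toℕ j))
    (≡.trans (≡.cong (if toℕ i <ᵇ toℕ j then 1# else_) (≡.trans (if-float proj₂ (toℕ i ≡ᵇ toℕ j)) (if-eta _)))
             (if-eta _))

  δqPerΞ-suc : ∀ q → q * q ≈ 1# → ∀ n →
    δqPerΞ q (suc n) ≈ ∑[ i < suc n ] (q ^ toℕ i * ∑[ x < suc n ] (q ^ toℕ x * 1# * qPer q n (minor i x (Ξ (suc n)))))
  δqPerΞ-suc q qq≈1 n = trans (proj₂-qPer q qq≈1 n (Ξε (suc n))) (sum-cong-≋ {suc n} (λ i → *-congˡ {q ^ toℕ i}
    (qPer-cong q (suc n) (λ r s → reflexive (entries i r s)))))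
    where
    entries : ∀ i r s → (dualPart (Ξε (suc n)) i ∷ removeAt (realPart (Ξε (suc n))) i) r s ≡ (const 1# ∷ removeAt (Ξ (suc n)) i) r s
    entries i fzero    s = dualPart-Ξε (suc n) i s
    entries i (fsuc r) s = realPart-Ξε (suc n) (punchIn i r) s

  -- In the first-row expansion the (0, 0)-minor is Ξ again, and the other minors have first column c;
  -- expanding them along it produces the (i, x)-minors of Ξ, which make up δqPerΞ-suc.
  qPerΞ-suc : ∀ q → q * q ≈ 1# → ∀ n → qPer q (suc n) (Ξ (suc n)) ≈ b * qPer q n (Ξ n) + q * (a * c) * δqPerΞ q n
  qPerΞ-suc q qq≈1 zero    = solve 3 (λ b q m → (con 1 :* b :* con 1 :+ con 0) := (b :* con 1 :+ q :* m :* con 0)) refl b q (a * c)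
  qPerΞ-suc q qq≈1 (suc n) = +-cong (*-congʳ (*-identityˡ b)) (begin
    ∑[ x < suc n ] (q * q ^ toℕ x * a * qPer q (suc n) (minor fzero (fsuc x) (Ξ (suc (suc n)))))
      ≈⟨ sum-cong-≋ {suc n} (λ x → *-congˡ {q * q ^ toℕ x * a} (qPer-expand-column q n (minor fzero (fsuc x) (Ξ (suc (suc n)))))) ⟩
    ∑[ x < suc n ] (q * q ^ toℕ x * a * ∑[ i < suc n ] (q ^ toℕ i * c * P i x))
      ≈⟨ ∑-*-∑-comm (suc n) (suc n) (λ x → q * q ^ toℕ x * a) (λ x i → q ^ toℕ i * c * P i x) ⟩
    ∑[ i < suc n ] ∑[ x < suc n ] (q * q ^ toℕ x * a * (q ^ toℕ i * c * P i x))
      ≈⟨ sum-cong-≋ {suc n} (λ i → sum-cong-≋ {suc n} (λ x → regroup (q ^ toℕ x) (q ^ toℕ i) (P i x))) ⟩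
    ∑[ i < suc n ] ∑[ x < suc n ] (q * (a * c) * (q ^ toℕ i * (q ^ toℕ x * 1# * P i x)))
      ≈⟨ sym (*-distribˡ-∑∑ (suc n) (suc n) (q * (a * c)) (λ i → q ^ toℕ i) (λ i x → q ^ toℕ x * 1# * P i x)) ⟩
    q * (a * c) * ∑[ i < suc n ] (q ^ toℕ i * ∑[ x < suc n ] (q ^ toℕ x * 1# * P i x))
      ≈⟨ *-congˡ {q * (a * c)} (sym (δqPerΞ-suc q qq≈1 n)) ⟩
    q * (a * c) * δqPerΞ q (suc n) ∎)
    where
    P : Fin (suc n) → Fin (suc n) → Carrier
    P i x = qPer q n (minor i x (Ξ (suc n)))
    regroup : ∀ u v p → q * u * a * (v * c * p) ≈ q * (a * c) * (v * (u * 1# * p))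
    regroup = solve 6 (λ q a c u v p → (q :* u :* a :* (v :* c :* p)) := (q :* (a :* c) :* (v :* (u :* con 1 :* p)))) refl q a c

module CauchyProduct {c ℓ} (R : CommutativeRing c ℓ) where
  open CommutativeRing R
  open import Data.List using () renaming (_∷_ to _∷ₗ_)
  open import Algebra.Solver.Ring.NaturalCoefficients.Default commutativeSemiring using (solve; _:+_; _:*_; _:=_; con)
  open import Relation.Binary.Reasoning.Setoid setoid

  cauchy : Series R → Series R → Series R
  cauchy f g zero    = f 0 * g 0
  cauchy f g (suc N) = f 0 * g (suc N) + cauchy (f ∘ suc) g N

  ⋆≈cauchy : ∀ N (f g : Series R) → _⋆_ R f g N ≈ cauchy f g N
  ⋆≈cauchy zero    f g = +-identityʳ _
  ⋆≈cauchy (suc N) f g = +-congˡ (trans (reflexive (≡.cong (sumR R) shift)) (⋆≈cauchy N (f ∘ suc) g))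
    where
    map-applyUpTo : ∀ {A : Set c} (F : ℕ → A) h n → map F (applyUpTo h n) ≡ applyUpTo (F ∘ h) n
    map-applyUpTo F h zero    = ≡.refl
    map-applyUpTo F h (suc n) = ≡.cong (F (h 0) ∷ₗ_) (map-applyUpTo F (h ∘ suc) n)
    term : ℕ → Carrier
    term k = f k * g (suc N ∸ k)
    shift : map term (applyUpTo suc (suc N)) ≡ map (term ∘ suc) (upTo (suc N))
    shift = ≡.trans (map-applyUpTo term suc (suc N)) (≡.sym (map-applyUpTo (term ∘ suc) id (suc N)))

  cauchy-cong : ∀ N {f f′ g g′ : Series R} → (∀ k → f k ≈ f′ k) → (∀ k → g k ≈ g′ k) → cauchy f g N ≈ cauchy f′ g′ N
  cauchy-cong zero    f≈ g≈ = *-cong (f≈ 0) (g≈ 0)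
  cauchy-cong (suc N) f≈ g≈ = +-cong (*-cong (f≈ 0) (g≈ (suc N))) (cauchy-cong N (f≈ ∘ suc) g≈)

  cauchy-linearˡ : ∀ N u v (f f′ g : Series R) →
    cauchy (λ k → u * f k + v * f′ k) g N ≈ u * cauchy f g N + v * cauchy f′ g N
  cauchy-linearˡ zero    u v f f′ g = solve 5 (λ u v a a′ b → ((u :* a :+ v :* a′) :* b) := (u :* (a :* b) :+ v :* (a′ :* b))) refl u v _ _ _
  cauchy-linearˡ (suc N) u v f f′ g = trans (+-congˡ (cauchy-linearˡ N u v (f ∘ suc) (f′ ∘ suc) g))
    (solve 7 (λ u v a a′ b x x′ → ((u :* a :+ v :* a′) :* b :+ (u :* x :+ v :* x′))
                               := (u :* (a :* b :+ x) :+ v :* (a′ :* b :+ x′))) refl u v _ _ _ _ _)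

  cauchy-linearʳ : ∀ N u v (f g g′ : Series R) →
    cauchy f (λ k → u * g k + v * g′ k) N ≈ u * cauchy f g N + v * cauchy f g′ N
  cauchy-linearʳ zero    u v f g g′ = solve 5 (λ u v a b b′ → (a :* (u :* b :+ v :* b′)) := (u :* (a :* b) :+ v :* (a :* b′))) refl u v _ _ _
  cauchy-linearʳ (suc N) u v f g g′ = trans (+-congˡ (cauchy-linearʳ N u v (f ∘ suc) g g′))
    (solve 7 (λ u v a b b′ x x′ → (a :* (u :* b :+ v :* b′) :+ (u :* x :+ v :* x′))
                               := (u :* (a :* b :+ x) :+ v :* (a :* b′ :+ x′))) refl u v _ _ _ _ _)

  derivative : Series R → Series R
  derivative f k = natR R (suc k) * f (suc k)

  derivative-suc : ∀ (f : Series R) k → derivative f (suc k) ≈ 1# * f (suc (suc k)) + 1# * derivative (f ∘ suc) k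
  derivative-suc f k = trans (distribʳ (f (suc (suc k))) 1# (natR R (suc k))) (+-congˡ (sym (*-identityˡ _)))

  derivative-cauchy : ∀ N (f g : Series R) →
    natR R (suc N) * cauchy f g (suc N) ≈ cauchy (derivative f) g N + cauchy f (derivative g) N
  derivative-cauchy zero    f g =
    solve 5 (λ n a b c d → (n :* (a :* b :+ c :* d)) := (n :* c :* d :+ a :* (n :* b))) refl (natR R 1) (f 0) (g 1) (f 1) (g 0)
  derivative-cauchy (suc N) f g = begin
    (1# + n) * (f 0 * g (suc (suc N)) + (f 1 * g (suc N) + C))
      ≈⟨ solve 6 (λ n a b c d e → ((con 1 :+ n) :* (a :* b :+ (c :* d :+ e))) := (a :* ((con 1 :+ n) :* b) :+ (c :* d :+ e) :+ n :* (c :* d :+ e))) refl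
                 n (f 0) (g (suc (suc N))) (f 1) (g (suc N)) C ⟩
    f 0 * derivative g (suc N) + (f 1 * g (suc N) + C) + n * cauchy (f ∘ suc) g (suc N)
      ≈⟨ +-congˡ (derivative-cauchy N (f ∘ suc) g) ⟩
    f 0 * derivative g (suc N) + (f 1 * g (suc N) + C) + (X + Y)
      ≈⟨ solve 6 (λ a b c d x y → (a :+ (c :* d :+ b) :+ (x :+ y)) := (c :* d :+ (b :+ x) :+ (a :+ y))) refl
                 (f 0 * derivative g (suc N)) C (f 1) (g (suc N)) X Y ⟩
    f 1 * g (suc N) + (C + X) + (f 0 * derivative g (suc N) + Y)
      ≈⟨ +-congʳ (+-cong (*-congʳ (sym (trans (*-congʳ (+-identityʳ 1#)) (*-identityˡ (f 1))))) (sym shifted-derivative)) ⟩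
    cauchy (derivative f) g (suc N) + cauchy f (derivative g) (suc N) ∎
    where
    n = natR R (suc N)
    C = cauchy (f ∘ suc ∘ suc) g N
    X = cauchy (derivative (f ∘ suc)) g N
    Y = cauchy (f ∘ suc) (derivative g) N
    shifted-derivative : cauchy (derivative f ∘ suc) g N ≈ C + X
    shifted-derivative = trans (cauchy-cong N (derivative-suc f) (λ _ → refl))
      (trans (cauchy-linearˡ N 1# 1# (f ∘ suc ∘ suc) (derivative (f ∘ suc)) g) (+-cong (*-identityˡ C) (*-identityˡ X)))

module ExponentialSeries {ℓ₁ ℓ₂} (R : CommutativeRing ℓ₁ ℓ₂) (inv : ℕ → CommutativeRing.Carrier R)
                         (a b c : CommutativeRing.Carrier R) where
  open CommutativeRing R
  open QPermanent R
  open XiRecurrence R a b c public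
  open import Algebra.Properties.Semiring.Exp semiring using (_^_; ^-congˡ)
  open import Algebra.Solver.Ring.NaturalCoefficients.Default commutativeSemiring using (solve; _:+_; _:*_; _:=_; con)
  open import Relation.Binary.Reasoning.Setoid setoid

  qPerSeries δqPerSeries : Carrier → Series R
  qPerSeries  q n = q ^ n * (invFact R inv n * qPer q n (Ξ n))
  δqPerSeries q n = q ^ n * (invFact R inv n * δqPerΞ q n)

  qPerSeries-congˡ : ∀ {q q′} n → q ≈ q′ → qPerSeries q n ≈ qPerSeries q′ n
  qPerSeries-congˡ n q≈q′ = *-cong (^-congˡ n q≈q′) (*-congˡ {invFact R inv n} (qPer-congˡ n (Ξ n) q≈q′))

  perSeries≈qPerSeries : ∀ n → perSeries R inv a b c n ≈ qPerSeries 1# n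
  perSeries≈qPerSeries zero    = sym (trans (*-identityˡ _) (*-identityˡ 1#))
  perSeries≈qPerSeries (suc n) = sym (trans (*-congʳ (^-zeroˡ (suc n)))
    (trans (*-identityˡ _) (*-congˡ {invFact R inv (suc n)} (sym (per≈qPer (suc n) (Ξ (suc n)))))))

  detSeries≈qPerSeries : ∀ n → detSeries R inv a b c n ≈ qPerSeries (- 1#) n
  detSeries≈qPerSeries zero    = sym (trans (*-identityˡ _) (*-identityˡ 1#))
  detSeries≈qPerSeries (suc n) =
    *-cong (negOnePow≈^ (suc n)) (*-congˡ {invFact R inv (suc n)} (det≈qPer (suc n) (Ξ (suc n))))

  qPerSeries-derivative : ∀ q → q * q ≈ 1# → (∀ n → natR R (suc n) * inv n ≈ 1#) → ∀ n →
    natR R (suc n) * qPerSeries q (suc n) ≈ q * b * qPerSeries q n + a * c * δqPerSeries q n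
  qPerSeries-derivative q qq≈1 inv-correct n = begin
    n₁ * (q * q ^ n * (F * inv n * qPer q (suc n) (Ξ (suc n))))
      ≈⟨ solve 6 (λ n₁ q u F i G → (n₁ :* (q :* u :* (F :* i :* G))) := (n₁ :* i :* (q :* u :* (F :* G)))) refl n₁ q (q ^ n) F (inv n) _ ⟩
    n₁ * inv n * (q * q ^ n * (F * qPer q (suc n) (Ξ (suc n))))
      ≈⟨ trans (*-congʳ (inv-correct n)) (*-identityˡ _) ⟩
    q * q ^ n * (F * qPer q (suc n) (Ξ (suc n)))
      ≈⟨ *-congˡ {q * q ^ n} (*-congˡ {F} (qPerΞ-suc q qq≈1 n)) ⟩
    q * q ^ n * (F * (b * qPer q n (Ξ n) + q * (a * c) * δqPerΞ q n))
      ≈⟨ solve 7 (λ q u F b G m δ → (q :* u :* (F :* (b :* G :+ q :* m :* δ))) := (q :* b :* (u :* (F :* G)) :+ q :* q :* (m :* (u :* (F :* δ))))) refl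
                 q (q ^ n) F b (qPer q n (Ξ n)) (a * c) (δqPerΞ q n) ⟩
    q * b * qPerSeries q n + q * q * (a * c * δqPerSeries q n)
      ≈⟨ +-congˡ (trans (*-congʳ qq≈1) (*-identityˡ _)) ⟩
    q * b * qPerSeries q n + a * c * δqPerSeries q n ∎
    where
    n₁ = natR R (suc n)
    F  = invFact R inv n

module SeriesIdentity {ℓ₁ ℓ₂} (R : CommutativeRing ℓ₁ ℓ₂) (inv : ℕ → CommutativeRing.Carrier R)
                      (a b c : CommutativeRing.Carrier R) where
  open CommutativeRing R
  open QPermanent R using (qPer-cong)
  open Jacobi R using (proj₁-^; proj₁-qPer; proj₂-scalar-^)
  open CauchyProduct R
  open ExponentialSeries R inv a b c
  open import Algebra.Properties.Ring ring using (-0#≈0#; -1*x≈-x; -‿involutive)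
  open import Algebra.Solver.Ring.NaturalCoefficients.Default commutativeSemiring using (solve; _:+_; _:*_; _:=_; con)
  open import Relation.Binary.Reasoning.Setoid setoid

  Rε : CommutativeRing ℓ₁ ℓ₂
  Rε = dualNumbers R
  module Rε = CommutativeRing Rε

  invε : ℕ → Carrier × Carrier
  invε n = inv n , 0#

  aε bε cε : Carrier × Carrier
  aε = a , 1#
  bε = b , 1#
  cε = c , 1#

  module Sε = ExponentialSeries Rε invε aε bε cε
  module Cε = CauchyProduct Rε
  open import Algebra.Properties.Semiring.Exp Rε.semiring using () renaming (_^_ to _^ε_)

  proj₁-natR : ∀ n → proj₁ (natR Rε n) ≡ natR R n
  proj₁-natR zero    = ≡.refl
  proj₁-natR (suc n) = ≡.cong (1# +_) (proj₁-natR n)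

  proj₂-natR : ∀ n → proj₂ (natR Rε n) ≈ 0#
  proj₂-natR zero    = refl
  proj₂-natR (suc n) = trans (+-congˡ (proj₂-natR n)) (+-identityʳ 0#)

  proj₁-invFact : ∀ n → proj₁ (invFact Rε invε n) ≡ invFact R inv n
  proj₁-invFact zero    = ≡.refl
  proj₁-invFact (suc n) = ≡.cong (_* inv n) (proj₁-invFact n)

  proj₂-invFact : ∀ n → proj₂ (invFact Rε invε n) ≈ 0#
  proj₂-invFact zero    = refl
  proj₂-invFact (suc n) = begin
    proj₁ (invFact Rε invε n) * 0# + proj₂ (invFact Rε invε n) * inv n ≈⟨ +-cong (zeroʳ _) (*-congʳ (proj₂-invFact n)) ⟩
    0# + 0# * inv n                                                     ≈⟨ trans (+-identityˡ _) (zeroˡ (inv n)) ⟩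
    0#                                                                  ∎

  inv-correctε : (∀ n → natR R (suc n) * inv n ≈ 1#) → ∀ n → natR Rε (suc n) Rε.* invε n Rε.≈ Rε.1#
  inv-correctε inv-correct n =
    trans (*-congʳ (reflexive (proj₁-natR (suc n)))) (inv-correct n) ,
    trans (+-cong (zeroʳ _) (*-congʳ (proj₂-natR (suc n)))) (trans (+-identityˡ _) (zeroˡ (inv n)))

  proj₁-qPerSeriesε : ∀ s n → proj₁ (Sε.qPerSeries s n) ≈ qPerSeries (proj₁ s) n
  proj₁-qPerSeriesε s n = *-cong (reflexive (proj₁-^ s n)) (*-cong (reflexive (proj₁-invFact n))
    (trans (proj₁-qPer s n (Ξε n)) (qPer-cong (proj₁ s) n (λ i j → reflexive (realPart-Ξε n i j)))))

  proj₂-qPerSeriesε : ∀ q n → proj₂ (Sε.qPerSeries (scalar q) n) ≈ δqPerSeries q n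
  proj₂-qPerSeriesε q n = begin
    s₁ * (F₁ * δ + F₂ * P₁) + s₂ * (F₁ * P₁)
      ≈⟨ +-cong (*-cong (reflexive (proj₁-^ (scalar q) n)) (+-cong (*-congʳ (reflexive (proj₁-invFact n))) (*-congʳ (proj₂-invFact n))))
                (*-congʳ (proj₂-scalar-^ q n)) ⟩
    q ^ n * (invFact R inv n * δ + 0# * P₁) + 0# * (F₁ * P₁)
      ≈⟨ solve 5 (λ u F δ x y → (u :* (F :* δ :+ con 0 :* x) :+ con 0 :* y) := (u :* (F :* δ))) refl _ _ _ _ _ ⟩
    δqPerSeries q n ∎
    where
    open import Algebra.Properties.Semiring.Exp semiring using (_^_)
    s₁ = proj₁ (scalar q ^ε n)
    s₂ = proj₂ (scalar q ^ε n)
    F₁ = proj₁ (invFact Rε invε n)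
    F₂ = proj₂ (invFact Rε invε n)
    P₁ = proj₁ (ε.qPer (scalar q) n (Ξε n))
    δ  = δqPerΞ q n

  perₛ detₛ δperₛ δdetₛ : Series R
  perₛ  = perSeries R inv a b c
  detₛ  = detSeries R inv a b c
  δperₛ = δqPerSeries 1#
  δdetₛ = δqPerSeries (- 1#)

  perₛε detₛε : Series Rε
  perₛε = perSeries Rε invε aε bε cε
  detₛε = detSeries Rε invε aε bε cε

  proj₁-perₛε : ∀ k → proj₁ (perₛε k) ≈ perₛ k
  proj₁-perₛε k = trans (proj₁ (Sε.perSeries≈qPerSeries k))
    (trans (proj₁-qPerSeriesε (scalar 1#) k) (sym (perSeries≈qPerSeries k)))

  proj₂-perₛε : ∀ k → proj₂ (perₛε k) ≈ δperₛ k
  proj₂-perₛε k = trans (proj₂ (Sε.perSeries≈qPerSeries k)) (proj₂-qPerSeriesε 1# k)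

  detₛε≈ : ∀ k → detₛε k Rε.≈ Sε.qPerSeries (scalar (- 1#)) k
  detₛε≈ k = Rε.trans (Sε.detSeries≈qPerSeries k) (Sε.qPerSeries-congˡ k (refl , -0#≈0#))

  proj₁-detₛε : ∀ k → proj₁ (detₛε k) ≈ detₛ k
  proj₁-detₛε k = trans (proj₁ (detₛε≈ k)) (trans (proj₁-qPerSeriesε (scalar (- 1#)) k) (sym (detSeries≈qPerSeries k)))

  proj₂-detₛε : ∀ k → proj₂ (detₛε k) ≈ δdetₛ k
  proj₂-detₛε k = trans (proj₂ (detₛε≈ k)) (proj₂-qPerSeriesε (- 1#) k)

  proj₂-cauchy : ∀ N (f g : Series Rε) →
    proj₂ (Cε.cauchy f g N) ≈ cauchy (proj₁ ∘ f) (proj₂ ∘ g) N + cauchy (proj₂ ∘ f) (proj₁ ∘ g) N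
  proj₂-cauchy zero    f g = refl
  proj₂-cauchy (suc N) f g = trans (+-congˡ (proj₂-cauchy N (f ∘ suc) g))
    (solve 4 (λ u v x y → (u :+ v :+ (x :+ y)) := (u :+ x :+ (v :+ y))) refl _ _ _ _)

  derivative-of-product : (∀ n → natR R (suc n) * inv n ≈ 1#) → ∀ N →
    natR R (suc N) * cauchy perₛ detₛ (suc N) ≈ a * c * proj₂ (Cε.cauchy perₛε detₛε N)
  derivative-of-product inv-correct N = begin
    natR R (suc N) * cauchy perₛ detₛ (suc N)
      ≈⟨ derivative-cauchy N perₛ detₛ ⟩
    cauchy (derivative perₛ) detₛ N + cauchy perₛ (derivative detₛ) N
      ≈⟨ +-cong (cauchy-cong N (derivative-series 1# (*-identityˡ 1#) perₛ perSeries≈qPerSeries) (λ _ → refl))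
                (cauchy-cong N (λ _ → refl) (derivative-series (- 1#) -1*-1 detₛ detSeries≈qPerSeries)) ⟩
    cauchy (λ k → 1# * b * perₛ k + a * c * δperₛ k) detₛ N + cauchy perₛ (λ k → - 1# * b * detₛ k + a * c * δdetₛ k) N
      ≈⟨ +-cong (cauchy-linearˡ N (1# * b) (a * c) perₛ δperₛ detₛ) (cauchy-linearʳ N (- 1# * b) (a * c) perₛ detₛ δdetₛ) ⟩
    1# * b * X + a * c * Y₁ + (- 1# * b * X + a * c * Y₂)
      ≈⟨ solve 6 (λ u v X m Y₁ Y₂ → (u :* X :+ m :* Y₁ :+ (v :* X :+ m :* Y₂)) := ((u :+ v) :* X :+ m :* (Y₂ :+ Y₁))) refl (1# * b) (- 1# * b) X (a * c) Y₁ Y₂ ⟩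
    (1# * b + - 1# * b) * X + a * c * (Y₂ + Y₁)
      ≈⟨ trans (+-congʳ (trans (*-congʳ b-cancels) (zeroˡ X))) (+-identityˡ _) ⟩
    a * c * (Y₂ + Y₁)
      ≈⟨ *-congˡ {a * c} (sym (trans (proj₂-cauchy N perₛε detₛε)
                              (+-cong (cauchy-cong N proj₁-perₛε proj₂-detₛε) (cauchy-cong N proj₂-perₛε proj₁-detₛε)))) ⟩
    a * c * proj₂ (Cε.cauchy perₛε detₛε N) ∎
    where
    X  = cauchy perₛ detₛ N
    Y₁ = cauchy δperₛ detₛ N
    Y₂ = cauchy perₛ δdetₛ N
    -1*-1 : - 1# * - 1# ≈ 1#
    -1*-1 = trans (-1*x≈-x (- 1#)) (-‿involutive 1#)
    b-cancels : 1# * b + - 1# * b ≈ 0#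
    b-cancels = trans (sym (distribʳ b 1# (- 1#))) (trans (*-congʳ (-‿inverseʳ 1#)) (zeroˡ b))
    derivative-series : ∀ q → q * q ≈ 1# → (s : Series R) → (∀ k → s k ≈ qPerSeries q k) →
                        ∀ k → derivative s k ≈ q * b * s k + a * c * δqPerSeries q k
    derivative-series q qq≈1 s s≈ k = trans (*-congˡ {natR R (suc k)} (s≈ (suc k)))
      (trans (qPerSeries-derivative q qq≈1 inv-correct k) (+-congʳ (*-congˡ {q * b} (sym (s≈ k)))))

perSeries⋆detSeries≈oneS : ∀ {ℓ₁ ℓ₂} N (R : CommutativeRing ℓ₁ ℓ₂) (inv : ℕ → CommutativeRing.Carrier R) →
  (∀ n → CommutativeRing._≈_ R (CommutativeRing._*_ R (natR R (suc n)) (inv n)) (CommutativeRing.1# R)) →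
  (a b c : CommutativeRing.Carrier R) →
  CommutativeRing._≈_ R (_⋆_ R (perSeries R inv a b c) (detSeries R inv a b c) N) (oneS R N)
perSeries⋆detSeries≈oneS zero    R inv inv-correct a b c = trans (+-identityʳ _) (*-identityˡ 1#)
  where open CommutativeRing R
perSeries⋆detSeries≈oneS (suc N) R inv inv-correct a b c = begin
  _⋆_ R perₛ detₛ (suc N)                                     ≈⟨ ⋆≈cauchy (suc N) perₛ detₛ ⟩
  cauchy perₛ detₛ (suc N)                                    ≈⟨ sym (trans (*-congʳ (trans (*-comm _ _) (inv-correct N))) (*-identityˡ _)) ⟩
  inv N * natR R (suc N) * cauchy perₛ detₛ (suc N)           ≈⟨ trans (*-assoc _ _ _) (*-congˡ {inv N} (derivative-of-product inv-correct N)) ⟩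
  inv N * (a * c * proj₂ (Cε.cauchy perₛε detₛε N))           ≈⟨ *-congˡ {inv N} (*-congˡ {a * c} dual-part-vanishes) ⟩
  inv N * (a * c * 0#)                                        ≈⟨ trans (*-congˡ {inv N} (zeroʳ _)) (zeroʳ _) ⟩
  0# ∎
  where
  open CommutativeRing R
  open CauchyProduct R
  open SeriesIdentity R inv a b c
  open import Relation.Binary.Reasoning.Setoid setoid
  dual-part-vanishes : proj₂ (Cε.cauchy perₛε detₛε N) ≈ 0#
  dual-part-vanishes = trans (sym (proj₂ (Cε.⋆≈cauchy N perₛε detₛε)))
    (trans (proj₂ (perSeries⋆detSeries≈oneS N Rε invε (inv-correctε inv-correct) aε bε cε)) (proj₂-oneS N))
    where
    proj₂-oneS : ∀ N → proj₂ (oneS Rε N) ≈ 0#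
    proj₂-oneS zero    = refl
    proj₂-oneS (suc N) = refl

mainTheorem15 : {ℓ₁ ℓ₂ : Level} (R : CommutativeRing ℓ₁ ℓ₂) →
    (inv : ℕ → CommutativeRing.Carrier R) →
    (∀ n → CommutativeRing._≈_ R (CommutativeRing._*_ R (natR R (suc n)) (inv n)) (CommutativeRing.1# R)) →
    (a b c : CommutativeRing.Carrier R) →
    (N : ℕ) →
    CommutativeRing._≈_ R (_⋆_ R (perSeries R inv a b c) (detSeries R inv a b c) N) (oneS R N)
mainTheorem15 R inv inv-correct a b c N = perSeries⋆detSeries≈oneS N R inv inv-correct a b c
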